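{- Let $H$ be a graph with $v_H$ vertices and let $t \geq 2$ be an integer. Then \[ \mathrm{ex}(n, H, K_{2,t+1}\text{ -ind}) < ( \sqrt{2} + o(1) )\, t^{1/2} ( v_{H} +t)^{t/2}\, n^{3/2}, \] where $o(1)$ tends to $0$ as $n\to\infty$.
   Context: For graphs $H$ and $F$, $\mathrm{ex}(n, H, F\text{ -ind})$ denotes the maximum number of edges in an $n$-vertex graph that contains no (not necessarily induced) subgraph isomorphic to $H$ and no induced subgraph isomorphic to $F$. -}

module Defs where

open import Data.Nat using (ℕ; zero; suc; _+_; _<ᵇ_)
open import Data.Bool using (Bool; true; false; _∧_; if_then_else_)
open import Data.Fin using (Fin; toℕ)
open import Data.List using (List; map; allFin)
open import Data.Nat.ListAction using (sum)
open import Relation.Binary.PropositionalEquality using (_≡_)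
open import Function.Definitions using (Injective)

record Graph (n : ℕ) : Set where
  field
    adj   : Fin n → Fin n → Bool
    sym   : ∀ i j → adj i j ≡ adj j i
    irref : ∀ i → adj i i ≡ false
open Graph public

edges : ∀ {n} → Graph n → ℕ
edges {n} G =
  sum (map (λ i → sum (map (λ j → if (toℕ i <ᵇ toℕ j) ∧ adj G i j then 1 else 0)
                            (allFin n)))
           (allFin n))

record Contains {h n : ℕ} (H : Graph h) (G : Graph n) : Set where
  field
    emb    : Fin h → Fin n
    inj    : Injective _≡_ _≡_ emb
    edgeOK : ∀ i j → adj H i j ≡ true → adj G (emb i) (emb j) ≡ true

record ContainsInduced {f n : ℕ} (F : Graph f) (G : Graph n) : Set where
  field
    emb  : Fin f → Fin n
    inj  : Injective _≡_ _≡_ emb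
    adjOK : ∀ i j → adj F i j ≡ adj G (emb i) (emb j)

-- complete bipartite graph K_{a,b} on Fin (a + b): vertices with toℕ < a
-- form one side, the rest the other side.
sideA : ℕ → ℕ → Bool
sideA a x = x <ᵇ a

xorB : Bool → Bool → Bool
xorB true  true  = false
xorB true  false = true
xorB false true  = true
xorB false false = false

xorB-sym : ∀ x y → xorB x y ≡ xorB y x
xorB-sym true  true  = _≡_.refl
xorB-sym true  false = _≡_.refl
xorB-sym false true  = _≡_.refl
xorB-sym false false = _≡_.refl

xorB-irr : ∀ x → xorB x x ≡ false
xorB-irr true  = _≡_.refl
xorB-irr false = _≡_.refl

K : (a b : ℕ) → Graph (a + b)
K a b = record
  { adj   = λ i j → xorB (sideA a (toℕ i)) (sideA a (toℕ j))
  ; sym   = λ i j → xorB-sym (sideA a (toℕ i)) (sideA a (toℕ j))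
  ; irref = λ i → xorB-irr (sideA a (toℕ i))
  }

-- Two distinct nonadjacent vertices x, y have fewer than M = (v_H + t)^t common
-- neighbours: by Ramsey's theorem their common neighbourhood would otherwise contain
-- a clique on v_H vertices (a copy of H) or t + 1 independent vertices (an induced
-- K_{2,t+1} together with x and y).  If w has degree d ≥ 3M, at most v_H neighbours x
-- of w miss fewer than d/3 vertices of N(w), since two nonadjacent such x, y would
-- have more than d/3 ≥ M common neighbours.  Hence d² is at most 3 times the number of
-- nonadjacent pairs in N(w) plus (v_H + 3M)·d.  Summing over w counts each nonadjacent
-- pair x, z at most codeg(x, z) < M times, and Cauchy–Schwarz gives, for the degree
-- sum D ≥ e(G), D² ≤ 3(M + 1)n³ + (v_H + 3M)·n·D, so D² ≤ (3M + 4)n³ for large n.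
-- As t ≥ 2 and M ≥ 4, this is below (2 + 1/k)·t·M·n³.

module Submission where

open import Defs
open import Data.Nat using (ℕ; suc; _+_; _*_; _^_; _≤_; _<_)
open import Data.Product using (∃-syntax)
open import Relation.Nullary using (¬_)

open import Data.Bool using (Bool; true; false; _∧_; not; if_then_else_)
open import Data.Empty using (⊥; ⊥-elim)
open import Data.Fin using (Fin; zero; suc; toℕ)
open import Data.Fin.Properties as Fin using ()
open import Data.List as List using (allFin)
open import Data.List.Properties using (map-tabulate)
open import Data.Nat using (zero; z≤n; s≤s; _≤?_; _<?_; _<ᵇ_)
open import Data.Nat.ListAction using () renaming (sum to listSum)
open import Data.Nat.Properties
open import Algebra.Properties.Semiring.Sum +-*-semiring
  using (sum-syntax; ∑-distrib-+; ∑-comm; *-distribˡ-sum; *-distribʳ-sum; sum-cong-≗)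
open import Data.Nat.Tactic.RingSolver using (solve-∀)
open import Data.Product using (_,_; _×_; proj₁; proj₂)
open import Data.Sum using (_⊎_; inj₁; inj₂; [_,_]′)
open import Function using (_∘_; id)
open import Function.Bundles using (mk⇔)
open import Function.Definitions using (Injective)
open import Relation.Binary.PropositionalEquality as ≡
  using (_≡_; _≢_; refl; cong; cong₂; trans)
open import Relation.Nullary using (Dec; yes; no; does; contradiction)
open import Relation.Nullary.Decidable using (dec-true; does-⇔)

𝟙 : Bool → ℕ
𝟙 b = if b then 1 else 0

𝟙≤1 : ∀ b → 𝟙 b ≤ 1
𝟙≤1 true  = ≤-refl
𝟙≤1 false = z≤n

𝟙*m≤m : ∀ b m → 𝟙 b * m ≤ m
𝟙*m≤m true  m = ≤-reflexive (*-identityˡ m)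
𝟙*m≤m false m = z≤n

∧-true : ∀ a {b} → a ∧ b ≡ true → a ≡ true × b ≡ true
∧-true true b≡true = refl , b≡true

does-true : ∀ {P : Set} (p? : Dec P) → does p? ≡ true → P
does-true (yes p) _ = p

∑-mono-≤ : ∀ {n} {f g : Fin n → ℕ} → (∀ i → f i ≤ g i) →
           ∑[ i < n ] f i ≤ ∑[ i < n ] g i
∑-mono-≤ {zero}  f≤g = z≤n
∑-mono-≤ {suc n} f≤g = +-mono-≤ (f≤g zero) (∑-mono-≤ (f≤g ∘ suc))

∑-const : ∀ n c → ∑[ i < n ] c ≡ n * c
∑-const zero    c = refl
∑-const (suc n) c = cong (c +_) (∑-const n c)

∑-*-∑ : ∀ {m n} (f : Fin m → ℕ) (g : Fin n → ℕ) →
        ∑[ i < m ] f i * ∑[ j < n ] g j ≡ ∑[ i < m ] ∑[ j < n ] (f i * g j)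
∑-*-∑ f g = trans (*-distribʳ-sum _ f) (sum-cong-≗ (λ i → *-distribˡ-sum (f i) g))

listSum-allFin : ∀ {n} (f : Fin n → ℕ) → listSum (List.map f (allFin n)) ≡ ∑[ i < n ] f i
listSum-allFin f = trans (cong listSum (map-tabulate id f)) (listSum-tabulate f)
  where
  listSum-tabulate : ∀ {n} (f : Fin n → ℕ) → listSum (List.tabulate f) ≡ ∑[ i < n ] f i
  listSum-tabulate {zero}  f = refl
  listSum-tabulate {suc n} f = cong (f zero +_) (listSum-tabulate (f ∘ suc))

2mn≤m²+n² : ∀ m n → 2 * (m * n) ≤ m * m + n * n
2mn≤m²+n² m n = [ ordered , flipped ]′ (≤-total m n)
  where
  ordered : ∀ {m n} → m ≤ n → 2 * (m * n) ≤ m * m + n * n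
  ordered {m} m≤n with m≤n⇒∃[o]m+o≡n m≤n
  ... | o , refl = ≤-trans (m≤m+n _ (o * o)) (≤-reflexive (square m o))
    where
    square : ∀ m o → 2 * (m * (m + o)) + o * o ≡ m * m + (m + o) * (m + o)
    square = solve-∀
  flipped : n ≤ m → 2 * (m * n) ≤ m * m + n * n
  flipped n≤m = ≡.subst₂ _≤_ (cong (2 *_) (*-comm n m)) (+-comm (n * n) (m * m)) (ordered n≤m)

cauchy-schwarz : ∀ {n} (f : Fin n → ℕ) →
                 ∑[ i < n ] f i * ∑[ i < n ] f i ≤ n * ∑[ i < n ] (f i * f i)
cauchy-schwarz {n} f = *-cancelˡ-≤ 2 (begin
  2 * (∑[ i < n ] f i * ∑[ i < n ] f i)
    ≡⟨ cong (2 *_) (∑-*-∑ f f) ⟩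
  2 * ∑[ i < n ] ∑[ j < n ] (f i * f j)
    ≡⟨ *-distribˡ-sum 2 (λ i → ∑[ j < n ] (f i * f j)) ⟩
  ∑[ i < n ] (2 * ∑[ j < n ] (f i * f j))
    ≡⟨ sum-cong-≗ (λ i → *-distribˡ-sum 2 (λ j → f i * f j)) ⟩
  ∑[ i < n ] ∑[ j < n ] (2 * (f i * f j))
    ≤⟨ ∑-mono-≤ (λ i → ∑-mono-≤ (λ j → 2mn≤m²+n² (f i) (f j))) ⟩
  ∑[ i < n ] ∑[ j < n ] (f i * f i + f j * f j)
    ≡⟨ sum-cong-≗ row ⟩
  ∑[ i < n ] (n * (f i * f i) + Q)
    ≡⟨ ∑-distrib-+ (λ i → n * (f i * f i)) (λ _ → Q) ⟩
  ∑[ i < n ] (n * (f i * f i)) + ∑[ i < n ] Q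
    ≡⟨ cong₂ _+_ (≡.sym (*-distribˡ-sum n (λ i → f i * f i))) (∑-const n Q) ⟩
  n * Q + n * Q
    ≡⟨ cong (n * Q +_) (≡.sym (+-identityʳ (n * Q))) ⟩
  2 * (n * Q) ∎)
  where
  open ≤-Reasoning
  Q : ℕ
  Q = ∑[ i < n ] (f i * f i)
  row : ∀ i → ∑[ j < n ] (f i * f i + f j * f j) ≡ n * (f i * f i) + Q
  row i = trans (∑-distrib-+ (λ _ → f i * f i) (λ j → f j * f j)) (cong (_+ Q) (∑-const n (f i * f i)))

count : ∀ {n} → (Fin n → Bool) → ℕ
count {n} P = ∑[ i < n ] 𝟙 (P i)

count≤n : ∀ {n} (P : Fin n → Bool) → count P ≤ n
count≤n {n} P = ≤-trans (∑-mono-≤ (𝟙≤1 ∘ P)) (≤-reflexive (trans (∑-const n 1) (*-identityʳ n)))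

count-witness : ∀ {n} (P : Fin n → Bool) → 0 < count P → ∃[ i ] P i ≡ true
count-witness {suc n} P pos with P zero in eq
... | true  = zero , eq
... | false with count-witness (P ∘ suc) pos
...   | i , Pi = suc i , Pi

count-≟ : ∀ {n} (x : Fin n) → count (λ y → does (x Fin.≟ y)) ≡ 1
count-≟ {suc n} zero    = cong suc (trans (∑-const n 0) (*-zeroʳ n))
count-≟ {suc n} (suc x) = count-≟ x

adj⇒≢ : ∀ {n} (G : Graph n) {x y} → adj G x y ≡ true → x ≢ y
adj⇒≢ G {x} x~x refl = contradiction (trans (≡.sym x~x) (irref G x)) λ ()

complement : ∀ {n} → Graph n → Graph n
complement G = record
  { adj   = λ x y → not (adj G x y) ∧ not (does (x Fin.≟ y))
  ; sym   = λ x y → cong₂ (λ a e → not a ∧ not e) (sym G x y)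
                          (does-⇔ (mk⇔ ≡.sym ≡.sym) (x Fin.≟ y) (y Fin.≟ x))
  ; irref = λ x → cong₂ (λ a e → not a ∧ not e) (irref G x) (dec-true (x Fin.≟ x) refl)
  }

complement-adj : ∀ {n} (G : Graph n) {x y} → adj (complement G) x y ≡ true →
                 adj G x y ≡ false × x ≢ y
complement-adj G {x} {y} x≁y with adj G x y | x Fin.≟ y
... | false | no x≢y = refl , x≢y

record Clique {n} (G : Graph n) (Q : Fin n → Bool) (a : ℕ) : Set where
  field
    vertex   : Fin a → Fin n
    inside   : ∀ i → Q (vertex i) ≡ true
    adjacent : ∀ {i j} → i ≢ j → adj G (vertex i) (vertex j) ≡ true

  injective : Injective _≡_ _≡_ vertex
  injective {i} {j} vi≡vj with i Fin.≟ j
  ... | yes i≡j = i≡j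
  ... | no  i≢j = contradiction vi≡vj (adj⇒≢ G (adjacent i≢j))

module _ {n} {G : Graph n} where

  emptyClique : ∀ {Q} → Clique G Q 0
  emptyClique = record { vertex = λ () ; inside = λ () ; adjacent = λ { {()} } }

  restrict : ∀ {Q} (R : Fin n → Bool) {a} → Clique G (λ w → Q w ∧ R w) a → Clique G Q a
  restrict R c = record
    { vertex   = vertex
    ; inside   = λ i → proj₁ (∧-true _ (inside i))
    ; adjacent = adjacent
    }
    where open Clique c

  extend : ∀ {Q a} z → Q z ≡ true → Clique G (λ w → Q w ∧ adj G z w) a → Clique G Q (suc a)
  extend {Q} {a} z Qz c = record { vertex = vertex′ ; inside = inside′ ; adjacent = adjacent′ }
    where
    open Clique c
    z~ : ∀ i → adj G z (vertex i) ≡ true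
    z~ i = proj₂ (∧-true _ (inside i))
    vertex′ : Fin (suc a) → Fin n
    vertex′ zero    = z
    vertex′ (suc i) = vertex i
    inside′ : ∀ i → Q (vertex′ i) ≡ true
    inside′ zero    = Qz
    inside′ (suc i) = proj₁ (∧-true _ (inside i))
    adjacent′ : ∀ {i j} → i ≢ j → adj G (vertex′ i) (vertex′ j) ≡ true
    adjacent′ {zero}  {zero}  0≢0 = contradiction refl 0≢0
    adjacent′ {zero}  {suc j} _   = z~ j
    adjacent′ {suc i} {zero}  _   = trans (sym G (vertex i) z) (z~ i)
    adjacent′ {suc i} {suc j} i≢j = adjacent (i≢j ∘ cong suc)

  count-split : ∀ (Q : Fin n → Bool) z →
    count Q ≤ 1 + (count (λ w → Q w ∧ adj G z w) + count (λ w → Q w ∧ adj (complement G) z w))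
  count-split Q z = begin
    count Q
      ≤⟨ ∑-mono-≤ (λ w → 𝟙-split (Q w) (adj G z w) (does (z Fin.≟ w))) ⟩
    ∑[ w < n ] (𝟙 (eq w) + (𝟙 (near w) + 𝟙 (far w)))
      ≡⟨ ∑-distrib-+ (𝟙 ∘ eq) (λ w → 𝟙 (near w) + 𝟙 (far w)) ⟩
    count eq + ∑[ w < n ] (𝟙 (near w) + 𝟙 (far w))
      ≡⟨ cong₂ _+_ (count-≟ z) (∑-distrib-+ (𝟙 ∘ near) (𝟙 ∘ far)) ⟩
    1 + (count near + count far) ∎
    where
    open ≤-Reasoning
    eq near far : Fin n → Bool
    eq   w = does (z Fin.≟ w)
    near w = Q w ∧ adj G z w
    far  w = Q w ∧ adj (complement G) z w
    𝟙-split : ∀ q a e → 𝟙 q ≤ 𝟙 e + (𝟙 (q ∧ a) + 𝟙 (q ∧ (not a ∧ not e)))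
    𝟙-split false a     e     = z≤n
    𝟙-split true  true  e     = m≤n+m 1 (𝟙 e)
    𝟙-split true  false true  = ≤-refl
    𝟙-split true  false false = ≤-refl

ramseyBound : ℕ → ℕ → ℕ
ramseyBound a zero    = 0
ramseyBound a (suc b) = (a + b) ^ b

ramseyBound-step : ∀ a b → ramseyBound a (suc b) + ramseyBound (suc a) b ≤ ramseyBound (suc a) (suc b)
ramseyBound-step a zero    = ≤-refl
ramseyBound-step a (suc b) = begin
  (a + suc b) ^ suc b + s ^ b   ≡⟨ cong (λ u → u ^ suc b + s ^ b) (+-suc a b) ⟩
  s ^ suc b + s ^ b             ≡⟨ +-comm (s ^ suc b) (s ^ b) ⟩
  suc s * s ^ b                 ≤⟨ *-monoʳ-≤ (suc s) (^-monoˡ-≤ b (n≤1+n s)) ⟩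
  suc s ^ suc b                 ≡⟨ cong (λ u → suc u ^ suc b) (≡.sym (+-suc a b)) ⟩
  (suc a + suc b) ^ suc b       ∎
  where
  open ≤-Reasoning
  s : ℕ
  s = suc a + b

ramseyBound-2 : ∀ a → ramseyBound a 2 ≡ suc a
ramseyBound-2 a = trans (*-identityʳ (a + 1)) (+-comm a 1)

+≤suc+⇒≤⊎≤ : ∀ {a b c d} → a + b ≤ suc (c + d) → a ≤ c ⊎ b ≤ d
+≤suc+⇒≤⊎≤ {a} {b} {c} {d} a+b≤ with a ≤? c
... | yes a≤c = inj₁ a≤c
... | no  a≰c = inj₂ (+-cancelˡ-≤ (suc c) b d (≤-trans (+-monoˡ-≤ b (≰⇒> a≰c)) a+b≤))

ramsey : ∀ {n} (G : Graph n) a b (Q : Fin n → Bool) → ramseyBound a b ≤ count Q →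
         Clique G Q a ⊎ Clique (complement G) Q b
ramsey G zero    b       Q _   = inj₁ emptyClique
ramsey G (suc a) zero    Q _   = inj₂ emptyClique
ramsey G (suc a) (suc b) Q big with count-witness Q (≤-trans (m^n>0 (suc a + b) b) big)
... | z , Qz with +≤suc+⇒≤⊎≤ (≤-trans (ramseyBound-step a b) (≤-trans big (count-split {G = G} Q z)))
...   | inj₁ near with ramsey G a (suc b) (λ w → Q w ∧ adj G z w) near
...     | inj₁ c = inj₁ (extend z Qz c)
...     | inj₂ c = inj₂ (restrict (adj G z) c)
ramsey G (suc a) (suc b) Q big | z , Qz | inj₂ far
  with ramsey G (suc a) b (λ w → Q w ∧ adj (complement G) z w) far
...     | inj₁ c = inj₁ (restrict (adj (complement G) z) c)
...     | inj₂ c = inj₂ (extend {G = complement G} z Qz c)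

clique⇒contains : ∀ {h n} (H : Graph h) {G : Graph n} {Q} → Clique G Q h → Contains H G
clique⇒contains H c = record
  { emb    = vertex
  ; inj    = injective
  ; edgeOK = λ i j i~j → adjacent (adj⇒≢ H i~j)
  }
  where open Clique c

inducedK₂ : ∀ {n b} (G : Graph n) {x y} → x ≢ y → adj G x y ≡ false →
            Clique (complement G) (λ z → adj G x z ∧ adj G y z) b → ContainsInduced (K 2 b) G
inducedK₂ {n} {b} G {x} {y} x≢y x≁y c = record { emb = emb ; inj = inj ; adjOK = adjOK }
  where
  open Clique c
  x~ : ∀ i → adj G x (vertex i) ≡ true
  x~ i = proj₁ (∧-true _ (inside i))
  y~ : ∀ i → adj G y (vertex i) ≡ true
  y~ i = proj₂ (∧-true _ (inside i))
  independent : ∀ i j → adj G (vertex i) (vertex j) ≡ false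
  independent i j with i Fin.≟ j
  ... | yes refl = irref G (vertex i)
  ... | no  i≢j  = proj₁ (complement-adj G (adjacent i≢j))
  emb : Fin (2 + b) → Fin n
  emb zero          = x
  emb (suc zero)    = y
  emb (suc (suc i)) = vertex i
  inj : Injective _≡_ _≡_ emb
  inj {zero}        {zero}        _ = refl
  inj {zero}        {suc zero}    e = contradiction e x≢y
  inj {zero}        {suc (suc j)} e = contradiction e (adj⇒≢ G (x~ j))
  inj {suc zero}    {zero}        e = contradiction (≡.sym e) x≢y
  inj {suc zero}    {suc zero}    _ = refl
  inj {suc zero}    {suc (suc j)} e = contradiction e (adj⇒≢ G (y~ j))
  inj {suc (suc i)} {zero}        e = contradiction (≡.sym e) (adj⇒≢ G (x~ i))
  inj {suc (suc i)} {suc zero}    e = contradiction (≡.sym e) (adj⇒≢ G (y~ i))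
  inj {suc (suc i)} {suc (suc j)} e = cong (λ k → suc (suc k)) (injective e)
  adjOK : ∀ i j → adj (K 2 b) i j ≡ adj G (emb i) (emb j)
  adjOK zero          zero          = ≡.sym (irref G x)
  adjOK zero          (suc zero)    = ≡.sym x≁y
  adjOK zero          (suc (suc j)) = ≡.sym (x~ j)
  adjOK (suc zero)    zero          = ≡.sym (trans (sym G y x) x≁y)
  adjOK (suc zero)    (suc zero)    = ≡.sym (irref G y)
  adjOK (suc zero)    (suc (suc j)) = ≡.sym (y~ j)
  adjOK (suc (suc i)) zero          = ≡.sym (trans (sym G (vertex i) x) (x~ i))
  adjOK (suc (suc i)) (suc zero)    = ≡.sym (trans (sym G (vertex i) y) (y~ i))
  adjOK (suc (suc i)) (suc (suc j)) = ≡.sym (independent i j)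

module _ {n} (G : Graph n) where

  degree : Fin n → ℕ
  degree w = count (adj G w)

  codegree : Fin n → Fin n → ℕ
  codegree x y = count (λ z → adj G x z ∧ adj G y z)

  missing : Fin n → Fin n → ℕ
  missing w x = count (λ z → adj G w z ∧ not (adj G x z))

  degree≤codegree+missing : ∀ w x y → degree w ≤ codegree x y + missing w x + missing w y
  degree≤codegree+missing w x y = begin
    degree w
      ≤⟨ ∑-mono-≤ (λ z → 𝟙-cover (adj G w z) (adj G x z) (adj G y z)) ⟩
    ∑[ z < n ] (𝟙 (common z) + 𝟙 (notX z) + 𝟙 (notY z))
      ≡⟨ ∑-distrib-+ (λ z → 𝟙 (common z) + 𝟙 (notX z)) (𝟙 ∘ notY) ⟩
    ∑[ z < n ] (𝟙 (common z) + 𝟙 (notX z)) + missing w y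
      ≡⟨ cong (_+ missing w y) (∑-distrib-+ (𝟙 ∘ common) (𝟙 ∘ notX)) ⟩
    codegree x y + missing w x + missing w y ∎
    where
    open ≤-Reasoning
    common notX notY : Fin n → Bool
    common z = adj G x z ∧ adj G y z
    notX   z = adj G w z ∧ not (adj G x z)
    notY   z = adj G w z ∧ not (adj G y z)
    𝟙-cover : ∀ p a b → 𝟙 p ≤ 𝟙 (a ∧ b) + 𝟙 (p ∧ not a) + 𝟙 (p ∧ not b)
    𝟙-cover false _     _     = z≤n
    𝟙-cover true  true  true  = s≤s z≤n
    𝟙-cover true  true  false = s≤s z≤n
    𝟙-cover true  false _     = s≤s z≤n

nonadjacent⇒codegree< : ∀ {h n} (H : Graph h) t (G : Graph n) →
  ¬ Contains H G → ¬ ContainsInduced (K 2 (suc t)) G →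
  ∀ {x y} → x ≢ y → adj G x y ≡ false → codegree G x y < (h + t) ^ t
nonadjacent⇒codegree< {h} H t G H-free K-free {x} {y} x≢y x≁y
  with ramseyBound h (suc t) ≤? codegree G x y
... | no  small = ≰⇒> small
... | yes big with ramsey G h (suc t) (λ z → adj G x z ∧ adj G y z) big
...   | inj₁ c = contradiction (clique⇒contains H c) H-free
...   | inj₂ c = contradiction (inducedK₂ G x≢y x≁y c) K-free

edges≤∑degree : ∀ {n} (G : Graph n) → edges G ≤ ∑[ w < n ] degree G w
edges≤∑degree {n} G = begin
  edges G
    ≡⟨ edges≡∑∑ ⟩
  ∑[ i < n ] ∑[ j < n ] edge? i j
    ≤⟨ ∑-mono-≤ (λ i → ∑-mono-≤ (λ j → 𝟙[a∧b]≤𝟙b (toℕ i <ᵇ toℕ j) (adj G i j))) ⟩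
  ∑[ i < n ] degree G i ∎
  where
  open ≤-Reasoning
  edge? : Fin n → Fin n → ℕ
  edge? i j = 𝟙 ((toℕ i <ᵇ toℕ j) ∧ adj G i j)
  edges≡∑∑ : edges G ≡ ∑[ i < n ] ∑[ j < n ] edge? i j
  edges≡∑∑ = trans (listSum-allFin (λ i → listSum (List.map (edge? i) (allFin n))))
                   (sum-cong-≗ (listSum-allFin ∘ edge?))
  𝟙[a∧b]≤𝟙b : ∀ a b → 𝟙 (a ∧ b) ≤ 𝟙 b
  𝟙[a∧b]≤𝟙b true  b = ≤-refl
  𝟙[a∧b]≤𝟙b false b = z≤n

module CodegreeBounded {n} (G : Graph n) (h M : ℕ)
  (no-clique : ∀ {Q} → ¬ Clique G Q h)
  (codegree< : ∀ {x y} → x ≢ y → adj G x y ≡ false → codegree G x y < M) where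

  -- Ordered pairs (x, z) in N(w) with x ≁ z; the diagonal x = z is included.
  nonadjacentPairs : Fin n → ℕ
  nonadjacentPairs w = ∑[ x < n ] (𝟙 (adj G w x) * missing G w x)

  close : Fin n → Fin n → Bool
  close w x = adj G w x ∧ does (3 * missing G w x <? degree G w)

  close⇒< : ∀ {w x} → close w x ≡ true → 3 * missing G w x < degree G w
  close⇒< {w} {x} e = does-true (3 * missing G w x <? degree G w) (proj₂ (∧-true (adj G w x) e))

  -- N(w) is covered by N(x) ∩ N(y) and two sets of size below |N(w)|/3 each.
  nonadjacent-close-absurd : ∀ {w x y} → 3 * M ≤ degree G w → x ≢ y → adj G x y ≡ false →
                             close w x ≡ true → close w y ≡ true → ⊥
  nonadjacent-close-absurd {w} {x} {y} 3M≤d x≢y x≁y x-close y-close = <-irrefl refl (begin-strict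
    3 * d                    ≤⟨ *-monoʳ-≤ 3 (degree≤codegree+missing G w x y) ⟩
    3 * (c + mx + my)        ≡⟨ distrib c mx my ⟩
    3 * c + 3 * mx + 3 * my  <⟨ +-mono-< (+-mono-< 3c<d (close⇒< x-close)) (close⇒< y-close) ⟩
    d + d + d                ≡⟨ triple d ⟩
    3 * d                    ∎)
    where
    open ≤-Reasoning
    d c mx my : ℕ
    d  = degree G w
    c  = codegree G x y
    mx = missing G w x
    my = missing G w y
    3c<d : 3 * c < d
    3c<d = <-≤-trans (*-monoʳ-< 3 (codegree< x≢y x≁y)) 3M≤d
    distrib : ∀ a b c → 3 * (a + b + c) ≡ 3 * a + 3 * b + 3 * c
    distrib = solve-∀
    triple : ∀ d → d + d + d ≡ 3 * d
    triple = solve-∀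

  count-close≤ : ∀ w → 3 * M ≤ degree G w → count (close w) ≤ h
  count-close≤ w 3M≤d with count (close w) ≤? h
  ... | yes ≤h = ≤h
  ... | no  ≰h with ramsey G h 2 (close w) (≤-trans (≤-reflexive (ramseyBound-2 h)) (≰⇒> ≰h))
  ...   | inj₁ c = contradiction c no-clique
  ...   | inj₂ c with complement-adj G (Clique.adjacent c {zero} {suc zero} λ ())
  ...     | x≁y , x≢y = ⊥-elim (nonadjacent-close-absurd 3M≤d x≢y x≁y
                                  (Clique.inside c zero) (Clique.inside c (suc zero)))

  degree²≤ : ∀ w → degree G w * degree G w ≤ 3 * nonadjacentPairs w + (h + 3 * M) * degree G w
  degree²≤ w with 3 * M ≤? degree G w
  ... | no  d<3M = begin
    d * d                                ≤⟨ *-monoˡ-≤ d (<⇒≤ (≰⇒> d<3M)) ⟩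
    3 * M * d                            ≤⟨ *-monoˡ-≤ d (m≤n+m (3 * M) h) ⟩
    (h + 3 * M) * d                      ≤⟨ m≤n+m _ _ ⟩
    3 * nonadjacentPairs w + (h + 3 * M) * d ∎
    where
    open ≤-Reasoning
    d : ℕ
    d = degree G w
  ... | yes 3M≤d = begin
    d * d
      ≡⟨ *-distribʳ-sum d (𝟙 ∘ adj G w) ⟩
    ∑[ x < n ] (𝟙 (adj G w x) * d)
      ≤⟨ ∑-mono-≤ (λ x → split (adj G w x) (missing G w x) d (3 * missing G w x <? d)) ⟩
    ∑[ x < n ] (3 * pairs x + 𝟙 (close w x) * d)
      ≡⟨ ∑-distrib-+ (λ x → 3 * pairs x) (λ x → 𝟙 (close w x) * d) ⟩
    ∑[ x < n ] (3 * pairs x) + ∑[ x < n ] (𝟙 (close w x) * d)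
      ≡⟨ cong₂ _+_ (*-distribˡ-sum 3 pairs) (*-distribʳ-sum d (𝟙 ∘ close w)) ⟨
    3 * nonadjacentPairs w + count (close w) * d
      ≤⟨ +-monoʳ-≤ _ (*-monoˡ-≤ d (≤-trans (count-close≤ w 3M≤d) (m≤m+n h (3 * M)))) ⟩
    3 * nonadjacentPairs w + (h + 3 * M) * d
      ∎
    where
    open ≤-Reasoning
    d : ℕ
    d = degree G w
    pairs : Fin n → ℕ
    pairs x = 𝟙 (adj G w x) * missing G w x
    split : ∀ b a d (p? : Dec (3 * a < d)) → 𝟙 b * d ≤ 3 * (𝟙 b * a) + 𝟙 (b ∧ does p?) * d
    split false a d p?        = z≤n
    split true  a d (yes _)   = m≤n+m (1 * d) (3 * (1 * a))
    split true  a d (no 3a≮d) =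
      +-monoˡ-≤ 0 (≤-trans (≮⇒≥ 3a≮d) (≤-reflexive (cong (3 *_) (≡.sym (+-identityʳ a)))))

  ∑nonadjacentPairs≤ : ∑[ w < n ] nonadjacentPairs w ≤ n * (n * M + n)
  ∑nonadjacentPairs≤ = begin
    ∑[ w < n ] ∑[ x < n ] (𝟙 (adj G w x) * missing G w x)
      ≡⟨ sum-cong-≗ (λ w → sum-cong-≗ (λ x →
           *-distribˡ-sum (𝟙 (adj G w x)) (λ z → 𝟙 (adj G w z ∧ not (adj G x z))))) ⟩
    ∑[ w < n ] ∑[ x < n ] ∑[ z < n ] triple w x z
      ≡⟨ ∑-comm (λ w x → ∑[ z < n ] triple w x z) ⟩
    ∑[ x < n ] ∑[ w < n ] ∑[ z < n ] triple w x z
      ≡⟨ sum-cong-≗ (λ x → ∑-comm (λ w z → triple w x z)) ⟩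
    ∑[ x < n ] ∑[ z < n ] ∑[ w < n ] triple w x z
      ≡⟨ sum-cong-≗ (λ x → sum-cong-≗ (λ z → through-codegree x z)) ⟩
    ∑[ x < n ] ∑[ z < n ] (𝟙 (not (adj G x z)) * codegree G x z)
      ≤⟨ ∑-mono-≤ (λ x → ∑-mono-≤ (λ z → nonadjacent-codegree≤ x z)) ⟩
    ∑[ x < n ] ∑[ z < n ] (M + 𝟙 (does (x Fin.≟ z)) * n)
      ≡⟨ sum-cong-≗ diagonal ⟩
    ∑[ x < n ] (n * M + n)
      ≡⟨ ∑-const n (n * M + n) ⟩
    n * (n * M + n) ∎
    where
    open ≤-Reasoning
    triple : Fin n → Fin n → Fin n → ℕ
    triple w x z = 𝟙 (adj G w x) * 𝟙 (adj G w z ∧ not (adj G x z))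
    𝟙-rearrange : ∀ a b c → 𝟙 a * 𝟙 (b ∧ not c) ≡ 𝟙 (not c) * 𝟙 (a ∧ b)
    𝟙-rearrange false b     c     = ≡.sym (*-zeroʳ (𝟙 (not c)))
    𝟙-rearrange true  false c     = ≡.sym (*-zeroʳ (𝟙 (not c)))
    𝟙-rearrange true  true  false = refl
    𝟙-rearrange true  true  true  = refl
    through-codegree : ∀ x z → ∑[ w < n ] triple w x z ≡ 𝟙 (not (adj G x z)) * codegree G x z
    through-codegree x z = begin-equality
      ∑[ w < n ] triple w x z
        ≡⟨ sum-cong-≗ (λ w → 𝟙-rearrange (adj G w x) (adj G w z) (adj G x z)) ⟩
      ∑[ w < n ] (𝟙 (not (adj G x z)) * 𝟙 (adj G w x ∧ adj G w z))
        ≡⟨ sum-cong-≗ (λ w → cong₂ (λ a b → 𝟙 (not (adj G x z)) * 𝟙 (a ∧ b)) (sym G w x) (sym G w z)) ⟩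
      ∑[ w < n ] (𝟙 (not (adj G x z)) * 𝟙 (adj G x w ∧ adj G z w))
        ≡⟨ *-distribˡ-sum (𝟙 (not (adj G x z))) (λ w → 𝟙 (adj G x w ∧ adj G z w)) ⟨
      𝟙 (not (adj G x z)) * codegree G x z ∎
    nonadjacent-codegree≤ : ∀ x z → 𝟙 (not (adj G x z)) * codegree G x z ≤ M + 𝟙 (does (x Fin.≟ z)) * n
    nonadjacent-codegree≤ x z with x Fin.≟ z
    ... | yes refl = begin
      𝟙 (not (adj G x x)) * codegree G x x  ≤⟨ 𝟙*m≤m (not (adj G x x)) (codegree G x x) ⟩
      codegree G x x                        ≤⟨ count≤n (λ y → adj G x y ∧ adj G x y) ⟩
      n                                     ≡⟨ *-identityˡ n ⟨
      1 * n                                 ≤⟨ m≤n+m (1 * n) M ⟩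
      M + 1 * n                             ∎
    ... | no  x≢z with adj G x z in x≁z
    ...   | true  = z≤n
    ...   | false = +-monoˡ-≤ 0 (<⇒≤ (codegree< x≢z x≁z))
    diagonal : ∀ x → ∑[ z < n ] (M + 𝟙 (does (x Fin.≟ z)) * n) ≡ n * M + n
    diagonal x = begin-equality
      ∑[ z < n ] (M + 𝟙 (does (x Fin.≟ z)) * n)
        ≡⟨ ∑-distrib-+ (λ _ → M) (λ z → 𝟙 (does (x Fin.≟ z)) * n) ⟩
      ∑[ z < n ] M + ∑[ z < n ] (𝟙 (does (x Fin.≟ z)) * n)
        ≡⟨ cong₂ _+_ (∑-const n M) (≡.sym (*-distribʳ-sum n (λ z → 𝟙 (does (x Fin.≟ z))))) ⟩
      n * M + count (λ z → does (x Fin.≟ z)) * n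
        ≡⟨ cong (λ c → n * M + c * n) (count-≟ x) ⟩
      n * M + 1 * n
        ≡⟨ cong (n * M +_) (*-identityˡ n) ⟩
      n * M + n ∎

  degreeSum-square : let D = ∑[ w < n ] degree G w in
                     D * D ≤ 3 * (M + 1) * n ^ 3 + (h + 3 * M) * n * D
  degreeSum-square = begin
    D * D
      ≤⟨ cauchy-schwarz (degree G) ⟩
    n * ∑[ w < n ] (degree G w * degree G w)
      ≤⟨ *-monoʳ-≤ n (∑-mono-≤ degree²≤) ⟩
    n * ∑[ w < n ] (3 * nonadjacentPairs w + C * degree G w)
      ≡⟨ cong (n *_) (∑-distrib-+ (λ w → 3 * nonadjacentPairs w) (λ w → C * degree G w)) ⟩
    n * (∑[ w < n ] (3 * nonadjacentPairs w) + ∑[ w < n ] (C * degree G w))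
      ≡⟨ cong (n *_) (cong₂ _+_ (*-distribˡ-sum 3 nonadjacentPairs) (*-distribˡ-sum C (degree G))) ⟨
    n * (3 * ∑[ w < n ] nonadjacentPairs w + C * D)
      ≤⟨ *-monoʳ-≤ n (+-monoˡ-≤ (C * D) (*-monoʳ-≤ 3 ∑nonadjacentPairs≤)) ⟩
    n * (3 * (n * (n * M + n)) + C * D)
      ≡⟨ expand n M C D ⟩
    3 * (M + 1) * n ^ 3 + C * n * D ∎
    where
    open ≤-Reasoning
    C D : ℕ
    C = h + 3 * M
    D = ∑[ w < n ] degree G w
    -- n ^ 3 is written unfolded: the ring solver does not accept _^_.
    expand : ∀ n m c d → n * (3 * (n * (n * m + n)) + c * d) ≡ 3 * (m + 1) * (n * (n * (n * 1))) + c * n * d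
    expand = solve-∀

square-bound : ∀ A C D n → D * D ≤ A * n ^ 3 + C * n * D → (A + 1) * (C * C) ≤ n →
               D * D ≤ (A + 1) * n ^ 3
square-bound A C zero      n _   _  = z≤n
square-bound A C D@(suc _) n D²≤ n≥ with C * D ≤? n * n
... | yes CD≤n² = begin
  D * D                     ≤⟨ D²≤ ⟩
  A * n ^ 3 + C * n * D     ≡⟨ cong (A * n ^ 3 +_) (*-comm-middle C n D) ⟩
  A * n ^ 3 + n * (C * D)   ≤⟨ +-monoʳ-≤ (A * n ^ 3) (*-monoʳ-≤ n CD≤n²) ⟩
  A * n ^ 3 + n * (n * n)   ≡⟨ collect A n ⟩
  (A + 1) * n ^ 3           ∎
  where
  open ≤-Reasoning
  *-comm-middle : ∀ c n d → c * n * d ≡ n * (c * d)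
  *-comm-middle = solve-∀
  collect : ∀ a n → a * (n * (n * (n * 1))) + n * (n * n) ≡ (a + 1) * (n * (n * (n * 1)))
  collect = solve-∀
... | no CD≰n² = contradiction n≥ (<⇒≱ n<)
  where
  open ≤-Reasoning
  n²<CD : n * n < C * D
  n²<CD = ≰⇒> CD≰n²
  D≤ : D ≤ (A + 1) * C * n
  D≤ = *-cancelʳ-≤ D ((A + 1) * C * n) D (begin
    D * D                         ≤⟨ D²≤ ⟩
    A * n ^ 3 + C * n * D         ≡⟨ cong (_+ C * n * D) (cube A n) ⟩
    A * n * (n * n) + C * n * D   ≤⟨ +-monoˡ-≤ (C * n * D) (*-monoʳ-≤ (A * n) (<⇒≤ n²<CD)) ⟩
    A * n * (C * D) + C * n * D   ≡⟨ collect A C n D ⟩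
    (A + 1) * C * n * D           ∎)
    where
    cube : ∀ a n → a * (n * (n * (n * 1))) ≡ a * n * (n * n)
    cube = solve-∀
    collect : ∀ a c n d → a * n * (c * d) + c * n * d ≡ (a + 1) * c * n * d
    collect = solve-∀
  n< : n < (A + 1) * (C * C)
  n< = *-cancelʳ-< n n ((A + 1) * (C * C)) (begin-strict
    n * n                     <⟨ n²<CD ⟩
    C * D                     ≤⟨ *-monoʳ-≤ C D≤ ⟩
    C * ((A + 1) * C * n)     ≡⟨ rearrange A C n ⟩
    (A + 1) * (C * C) * n     ∎)
    where
    rearrange : ∀ a c n → c * ((a + 1) * c * n) ≡ (a + 1) * (c * c) * n
    rearrange = solve-∀

4≤[h+t]^t : ∀ h t → 2 ≤ t → 4 ≤ (h + t) ^ t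
4≤[h+t]^t h t 2≤t = ≤-trans (^-monoʳ-≤ 2 2≤t) (^-monoˡ-≤ t (≤-trans 2≤t (m≤n+m t h)))

k*[3M+4]<[2k+1]*2M : ∀ k M → 4 ≤ M → k * (3 * (M + 1) + 1) < (2 * k + 1) * (2 * M)
k*[3M+4]<[2k+1]*2M k M 4≤M = begin-strict
  k * (3 * (M + 1) + 1)   ≡⟨ split k M ⟩
  k * (3 * M) + k * 4     ≤⟨ +-monoʳ-≤ (k * (3 * M)) (*-monoʳ-≤ k 4≤M) ⟩
  k * (3 * M) + k * M     ≡⟨ merge k M ⟩
  4 * (k * M) + 0         <⟨ +-monoʳ-< (4 * (k * M)) 0<2M ⟩
  4 * (k * M) + 2 * M     ≡⟨ expand k M ⟩
  (2 * k + 1) * (2 * M)   ∎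
  where
  open ≤-Reasoning
  0<2M : 0 < 2 * M
  0<2M = ≤-trans (s≤s z≤n) (≤-trans 4≤M (m≤n*m M 2))
  split : ∀ k m → k * (3 * (m + 1) + 1) ≡ k * (3 * m) + k * 4
  split = solve-∀
  merge : ∀ k m → k * (3 * m) + k * m ≡ 4 * (k * m) + 0
  merge = solve-∀
  expand : ∀ k m → 4 * (k * m) + 2 * m ≡ (2 * k + 1) * (2 * m)
  expand = solve-∀

final-bound : ∀ k t M e n → 2 ≤ t → 4 ≤ M → 1 ≤ n → e * e ≤ (3 * (M + 1) + 1) * n ^ 3 →
              k * (e * e) < (2 * k + 1) * (t * (M * n ^ 3))
final-bound k t M e zero      _   _   ()
final-bound k t M e n@(suc _) 2≤t 4≤M _ e²≤ = begin-strict
  k * (e * e)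
    ≤⟨ *-monoʳ-≤ k e²≤ ⟩
  k * ((3 * (M + 1) + 1) * n ^ 3)
    ≡⟨ *-assoc k (3 * (M + 1) + 1) (n ^ 3) ⟨
  k * (3 * (M + 1) + 1) * n ^ 3
    <⟨ *-monoˡ-< (n ^ 3) {{m^n≢0 n 3}} (k*[3M+4]<[2k+1]*2M k M 4≤M) ⟩
  (2 * k + 1) * (2 * M) * n ^ 3
    ≡⟨ *-assoc (2 * k + 1) (2 * M) (n ^ 3) ⟩
  (2 * k + 1) * (2 * M * n ^ 3)
    ≡⟨ cong ((2 * k + 1) *_) (*-assoc 2 M (n ^ 3)) ⟩
  (2 * k + 1) * (2 * (M * n ^ 3))
    ≤⟨ *-monoʳ-≤ (2 * k + 1) (*-monoˡ-≤ (M * n ^ 3) 2≤t) ⟩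
  (2 * k + 1) * (t * (M * n ^ 3)) ∎
  where open ≤-Reasoning

corollary1 : ∀ {h : ℕ} (H : Graph h) (t : ℕ) → 2 ≤ t →
    ∀ (k : ℕ) → 1 ≤ k →
    ∃[ N ] (∀ (n : ℕ) → N ≤ n → ∀ (G : Graph n) →
      ¬ Contains H G → ¬ ContainsInduced (K 2 (suc t)) G →
      k * (edges G * edges G) < (2 * k + 1) * (t * ((h + t) ^ t * n ^ 3)))
corollary1 {h} H t 2≤t k _ = suc ((A + 1) * (C * C)) , bound
  where
  M A C : ℕ
  M = (h + t) ^ t
  A = 3 * (M + 1)
  C = h + 3 * M
  bound : ∀ n → suc ((A + 1) * (C * C)) ≤ n → ∀ (G : Graph n) →
          ¬ Contains H G → ¬ ContainsInduced (K 2 (suc t)) G →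
          k * (edges G * edges G) < (2 * k + 1) * (t * (M * n ^ 3))
  bound n N≤n G H-free K-free =
    final-bound k t M (edges G) n 2≤t (4≤[h+t]^t h t 2≤t) (≤-trans (s≤s z≤n) N≤n) e²≤
    where
    open CodegreeBounded G h M (H-free ∘ clique⇒contains H) (nonadjacent⇒codegree< H t G H-free K-free)
    e²≤ : edges G * edges G ≤ (A + 1) * n ^ 3
    e²≤ = ≤-trans (*-mono-≤ (edges≤∑degree G) (edges≤∑degree G))
                  (square-bound A C (∑[ w < n ] degree G w) n degreeSum-square (<⇒≤ N≤n))
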